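{- Let $G$ be a finite graph, let $A,B \subseteq V(G)$ with $B\subseteq A$, and let $uv$ be an edge of $G$. Then \[ \gamma_g(G|A) \le \gamma_g(G_{uv}|B) \quad \text{and} \quad \gamma_g^\prime(G|A) \le \gamma_g^\prime(G_{uv}|B). \]
   Context: Domination game: on a graph, Dominator and Staller alternately choose vertices; a chosen vertex must dominate (i.e. its closed neighborhood must contain) at least one vertex not dominated by the previously chosen vertices (a legal move). The game ends when no legal move exists. Dominator wants to minimize the total number of moves, Staller to maximize it. For $S\subseteq V(G)$, the partially dominated graph $G|S$ is $G$ with the vertices of $S$ declared already dominated; $\gamma_g(G|S)$ (resp. $\gamma_g^\prime(G|S)$) is the number of moves remaining under optimal play when Dominator (resp. Staller) moves first. For an edge $uv$ of $G$, $G_{uv}$ is the graph obtained from $G-uv$ by adding two new vertices $u',v'$ and the edges $uv'$ and $vu'$, with $u'$ and $v'$ declared dominated; for $B\subseteq V(G)$, $G_{uv}|B$ denotes $G_{uv}$ in which the vertices of $B\cup\{u',v'\}$ are declared dominated. -}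

module Defs where

open import Data.Nat using (ℕ; zero; suc; _⊓_; _⊔_)
open import Data.Bool using (Bool; true; false; _∧_; _∨_; not)
open import Data.Fin using (Fin; zero; suc; _≟_)
open import Data.Fin.Subset using (Subset)
open import Data.List using (List; []; _∷_; map; foldr; filterᵇ; allFin)
open import Data.Bool.ListAction using (any)
open import Data.Vec using (lookup; tabulate)
open import Relation.Nullary.Decidable using (⌊_⌋)
open import Relation.Binary.PropositionalEquality using (_≡_)

Adj : ℕ → Set
Adj n = Fin n → Fin n → Bool

record Graph (n : ℕ) : Set where
  field
    adj    : Adj n
    sym    : ∀ x y → adj x y ≡ adj y x
    irrefl : ∀ x → adj x x ≡ false
open Graph public

closedN : ∀ {n} → Adj n → Fin n → Fin n → Bool
closedN a v w = ⌊ v ≟ w ⌋ ∨ a v w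

legal : ∀ {n} → Adj n → Subset n → Fin n → Bool
legal {n} a D v = any (λ w → closedN a v w ∧ not (lookup D w)) (allFin n)

play : ∀ {n} → Adj n → Subset n → Fin n → Subset n
play a D v = tabulate (λ w → lookup D w ∨ closedN a v w)

data Player : Set where
  Dominator Staller : Player

other : Player → Player
other Dominator = Staller
other Staller   = Dominator

-- minimum / maximum of a nonempty list (value on [] irrelevant; never used)
minL : List ℕ → ℕ
minL []       = 0
minL (x ∷ xs) = foldr _⊓_ x xs

maxL : List ℕ → ℕ
maxL = foldr _⊔_ 0

opt : Player → List ℕ → ℕ
opt Dominator = minL
opt Staller   = maxL

-- value k p a D : number of remaining moves under optimal play, player p to
-- move, with at most k further moves explored (fuel). Every legal move
-- dominates a new vertex, so the game lasts at most n moves; fuel n is exact.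
value : ∀ {n} → ℕ → Player → Adj n → Subset n → ℕ
valueL : ∀ {n} → ℕ → Player → Adj n → Subset n → List (Fin n) → ℕ

value zero    p a D = 0
value (suc k) p a D = valueL k p a D (filterᵇ (legal a D) (allFin _))

valueL k p a D []       = 0
valueL k p a D (v ∷ vs) =
  suc (opt p (map (λ w → value k (other p) a (play a D w)) (v ∷ vs)))

γg : ∀ {n} → Adj n → Subset n → ℕ
γg {n} a D = value n Dominator a D

γg' : ∀ {n} → Adj n → Subset n → ℕ
γg' {n} a D = value n Staller a D

-- G_uv on vertex set Fin (2 + n): zero = u', suc zero = v',
-- suc (suc w) = old vertex w. Edges: those of G except uv, plus u v' and v u'.
Guv : ∀ {n} → Adj n → Fin n → Fin n → Adj (suc (suc n))
Guv a u v zero          zero          = false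
Guv a u v zero          (suc zero)    = false
Guv a u v zero          (suc (suc w)) = ⌊ w ≟ v ⌋
Guv a u v (suc zero)    zero          = false
Guv a u v (suc zero)    (suc zero)    = false
Guv a u v (suc zero)    (suc (suc w)) = ⌊ w ≟ u ⌋
Guv a u v (suc (suc w)) zero          = ⌊ w ≟ v ⌋
Guv a u v (suc (suc w)) (suc zero)    = ⌊ w ≟ u ⌋
Guv a u v (suc (suc w)) (suc (suc x)) =
  a w x ∧ not ((⌊ w ≟ u ⌋ ∧ ⌊ x ≟ v ⌋) ∨ (⌊ w ≟ v ⌋ ∧ ⌊ x ≟ u ⌋))

-- the dominated set of G_uv|B : B ∪ {u', v'}
liftB : ∀ {n} → Subset n → Subset (suc (suc n))
liftB B = true Data.Vec.∷ true Data.Vec.∷ B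

-- Call a vertex of G_uv old if it is a vertex of G. The invariant is that every old vertex
-- dominated in G_uv|B is dominated in G|A, and it survives each move. A legal move x on G
-- is copied on G_uv by a vertex dominating some undominated w ∈ N[x] but no old vertex
-- outside N[x]: x itself, or u' when (x, w) = (u, v), or v' when (x, w) = (v, u). A move y on
-- G_uv is answered on G by its projection (u' ↦ v, v' ↦ u, w ↦ w), whose closed
-- neighbourhood contains every old vertex y dominates, or by an arbitrary legal move if the
-- projection is no longer legal.
module Submission where

open import Defs
open import Data.Nat using (ℕ; zero; suc; _+_; _≤_; _<_; z≤n; s≤s)
open import Data.Nat.Properties
  using (≤-reflexive; ≤-pred; <-≤-trans; n≮0; m≤n⇒m≤o+n; ⊓-glb; ⊔-lub;
         m≤n⇒m⊓o≤n; m≤n⇒o⊓m≤n; m≤n⇒m≤n⊔o; m≤n⇒m≤o⊔n)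
open import Data.Bool using (true; false; _∧_; not; T)
open import Data.Bool.Properties using (T-≡; T-∨; T-∧)
open import Data.Fin using (Fin; zero; suc; _≟_)
open import Data.Fin.Subset using (Subset; _∈_; _∉_; _⊆_; ∁; ∣_∣)
open import Data.Fin.Subset.Properties
  using (_∈?_; drop-there; ∣p∣≤n; p⊂q⇒∣p∣<∣q∣; p⊆q⇒∁p⊇∁q; x∉p⇒x∈∁p; x∈p⇒x∉∁p)
open import Data.List using (List; []; _∷_; map; filterᵇ; allFin)
open import Data.List.Properties using (foldr-preservesᵇ; foldr-preservesᵒ)
open import Data.List.Relation.Unary.All as All using (All; _∷_)
import Data.List.Relation.Unary.All.Properties as Allₚ
open import Data.List.Relation.Unary.Any as Any using (Any)
import Data.List.Relation.Unary.Any.Properties as Anyₚ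
open import Data.List.Membership.Propositional as List using (lose)
open import Data.List.Membership.Propositional.Properties using (∈-filter⁺; ∈-filter⁻; ∈-allFin)
open import Data.Vec using (lookup)
open import Data.Vec.Properties using ([]=⇒lookup; lookup⇒[]=; lookup∘tabulate)
open import Data.Product using (_×_; _,_; proj₁; proj₂; ∃-syntax) renaming (map to ×-map)
open import Data.Sum using (_⊎_; inj₁; inj₂; [_,_]) renaming (map to ⊎-map; map₁ to ⊎-map₁)
open import Data.Unit using (tt)
open import Data.Empty using (⊥)
open import Function using (_∘_; Equivalence)
open import Relation.Nullary using (¬_; Dec; yes; no; contradiction)
open import Relation.Nullary.Decidable using (⌊_⌋; T?; toWitness; fromWitness; _×-dec_; _⊎-dec_)
open import Relation.Binary.PropositionalEquality using (_≡_; refl; subst) renaming (sym to ≡-sym)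

open Equivalence using (to; from)

private
  variable
    n n₁ n₂ : ℕ

minL-≤ : ∀ {c} xs → Any (_≤ c) xs → minL xs ≤ c
minL-≤ (x ∷ xs) = foldr-preservesᵒ (λ m o → [ m≤n⇒m⊓o≤n o , m≤n⇒o⊓m≤n m ]) x xs ∘ Any.toSum

≤-minL : ∀ {c x xs} → All (c ≤_) (x ∷ xs) → c ≤ minL (x ∷ xs)
≤-minL (c≤x ∷ c≤xs) = foldr-preservesᵇ ⊓-glb c≤x c≤xs

maxL-≤ : ∀ {c} {xs : List ℕ} → All (_≤ c) xs → maxL xs ≤ c
maxL-≤ = foldr-preservesᵇ ⊔-lub z≤n

≤-maxL : ∀ {c} xs → Any (c ≤_) xs → c ≤ maxL xs
≤-maxL xs = foldr-preservesᵒ (λ m o → [ m≤n⇒m≤n⊔o o , m≤n⇒m≤o⊔n m ]) 0 xs ∘ inj₂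

opt-mono : ∀ p {A B : Set} (f : A → ℕ) (g : B → ℕ) xs y ys →
           All (λ a → Any (λ b → f a ≤ g b) (y ∷ ys)) xs →
           All (λ b → Any (λ a → f a ≤ g b) xs) (y ∷ ys) →
           opt p (map f xs) ≤ opt p (map g (y ∷ ys))
opt-mono Dominator f g xs y ys _ back =
  ≤-minL (Allₚ.map⁺ (All.map (minL-≤ (map f xs) ∘ Anyₚ.map⁺) back))
opt-mono Staller f g xs y ys forth _ =
  maxL-≤ (Allₚ.map⁺ (All.map (≤-maxL (map g (y ∷ ys)) ∘ Anyₚ.map⁺) forth))

T-lookup⇒∈ : {D : Subset n} {w : Fin n} → T (lookup D w) → w ∈ D
T-lookup⇒∈ {D = D} {w} = lookup⇒[]= w D ∘ to T-≡

∈⇒T-lookup : {D : Subset n} {w : Fin n} → w ∈ D → T (lookup D w)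
∈⇒T-lookup = from T-≡ ∘ []=⇒lookup

¬T⇒T-not : ∀ {b} → ¬ T b → T (not b)
¬T⇒T-not {false} _  = tt
¬T⇒T-not {true}  ¬t = ¬t tt

T-not⇒¬T : ∀ {b} → T (not b) → ¬ T b
T-not⇒¬T {false} _ ()

module _ (a : Adj n) (D : Subset n) (x : Fin n) where

  ∈-play⁺ : ∀ {w} → w ∈ D ⊎ T (closedN a x w) → w ∈ play a D x
  ∈-play⁺ {w} = T-lookup⇒∈ ∘ subst T (≡-sym (lookup∘tabulate _ w)) ∘ from T-∨ ∘ ⊎-map₁ ∈⇒T-lookup

  ∈-play⁻ : ∀ {w} → w ∈ play a D x → w ∈ D ⊎ T (closedN a x w)
  ∈-play⁻ {w} = ⊎-map₁ T-lookup⇒∈ ∘ to T-∨ ∘ subst T (lookup∘tabulate _ w) ∘ ∈⇒T-lookup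

  ⊆-play : D ⊆ play a D x
  ⊆-play = ∈-play⁺ ∘ inj₁

  legal⁺ : ∀ {w} → T (closedN a x w) → w ∉ D → T (legal a D x)
  legal⁺ {w} x~w w∉D =
    Anyₚ.any⁺ _ (Anyₚ.tabulate⁺ w (from T-∧ (x~w , ¬T⇒T-not (w∉D ∘ T-lookup⇒∈))))

  legal⁻ : T (legal a D x) → ∃[ w ] T (closedN a x w) × w ∉ D
  legal⁻ l with Any.satisfied (Anyₚ.any⁻ _ (allFin n) l)
  ... | w , t with to T-∧ t
  ...   | x~w , w∉D = w , x~w , T-not⇒¬T w∉D ∘ ∈⇒T-lookup

  illegal⇒dominated : ∀ {w} → ¬ T (legal a D x) → T (closedN a x w) → w ∈ D
  illegal⇒dominated {w} ¬l x~w with w ∈? D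
  ... | yes w∈D = w∈D
  ... | no  w∉D = contradiction (legal⁺ x~w w∉D) ¬l

  legal⇒∣∁∣-decreases : T (legal a D x) → ∣ ∁ (play a D x) ∣ < ∣ ∁ D ∣
  legal⇒∣∁∣-decreases l with legal⁻ l
  ... | w , x~w , w∉D = p⊂q⇒∣p∣<∣q∣ {p = ∁ (play a D x)} {∁ D}
    (p⊆q⇒∁p⊇∁q ⊆-play , w , x∉p⇒x∈∁p w∉D , x∈p⇒x∉∁p (∈-play⁺ (inj₂ x~w)))

moves : Adj n → Subset n → List (Fin n)
moves a D = filterᵇ (legal a D) (allFin _)

module _ (a : Adj n) (D : Subset n) {x : Fin n} where

  ∈-moves⁺ : T (legal a D x) → x List.∈ moves a D
  ∈-moves⁺ = ∈-filter⁺ (T? ∘ legal a D) (∈-allFin x)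

  ∈-moves⁻ : x List.∈ moves a D → T (legal a D x)
  ∈-moves⁻ = proj₂ ∘ ∈-filter⁻ (T? ∘ legal a D) {xs = allFin _}

valueL-no-moves : ∀ {k p} {a : Adj n} {D : Subset n} xs →
                  (∀ {x} → x List.∈ xs → ⊥) → valueL k p a D xs ≡ 0
valueL-no-moves []      _   = refl
valueL-no-moves (_ ∷ _) ∉xs = contradiction (Any.here refl) ∉xs

CoveredBy : Adj n₁ → Adj n₂ → (Fin n₁ → Fin n₂) → Fin n₂ → Fin n₁ → Set
CoveredBy a₁ a₂ ι y x = ∀ {z} → T (closedN a₂ y (ι z)) → T (closedN a₁ x z)

record Simulation (a₁ : Adj n₁) (a₂ : Adj n₂) : Set where
  field
    ι              : Fin n₁ → Fin n₂
    project        : Fin n₂ → Fin n₁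
    project-covers : ∀ y → CoveredBy a₁ a₂ ι y (project y)
    cover          : ∀ {x w} → T (closedN a₁ x w) →
                     ∃[ y ] T (closedN a₂ y (ι w)) × CoveredBy a₁ a₂ ι y x

module Simulate {a₁ : Adj n₁} {a₂ : Adj n₂} (S : Simulation a₁ a₂) where
  open Simulation S

  Ahead : Subset n₁ → Subset n₂ → Set
  Ahead D₁ D₂ = ∀ {w} → ι w ∈ D₂ → w ∈ D₁

  module _ {D₁ : Subset n₁} {D₂ : Subset n₂} (r : Ahead D₁ D₂) where

    Ahead-play : ∀ {x y} → CoveredBy a₁ a₂ ι y x → Ahead (play a₁ D₁ x) (play a₂ D₂ y)
    Ahead-play {x} {y} y⊑x = ∈-play⁺ a₁ D₁ x ∘ [ inj₁ ∘ r , inj₂ ∘ y⊑x ] ∘ ∈-play⁻ a₂ D₂ y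

    copy-move : ∀ {x} → T (legal a₁ D₁ x) →
                ∃[ y ] T (legal a₂ D₂ y) × Ahead (play a₁ D₁ x) (play a₂ D₂ y)
    copy-move {x} l with legal⁻ a₁ D₁ x l
    ... | w , x~w , w∉D₁ with cover x~w
    ...   | y , y~w , y⊑x = y , legal⁺ a₂ D₂ y y~w (w∉D₁ ∘ r) , Ahead-play y⊑x

    -- If the projection of y is no longer legal, y dominates no new vertex of game 1,
    -- so any legal move of game 1 keeps it ahead.
    answer-move : ∀ {x₀} → T (legal a₁ D₁ x₀) → ∀ y →
                  ∃[ x ] T (legal a₁ D₁ x) × Ahead (play a₁ D₁ x) (play a₂ D₂ y)
    answer-move {x₀} l₀ y with T? (legal a₁ D₁ (project y))
    ... | yes l = project y , l , Ahead-play (project-covers y)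
    ... | no ¬l = x₀ , l₀ , ⊆-play a₁ D₁ x₀
                          ∘ [ r , illegal⇒dominated a₁ D₁ (project y) ¬l ∘ project-covers y ]
                          ∘ ∈-play⁻ a₂ D₂ y

  valueL-mono : ∀ {k₁ k₂} p {D₁ D₂} xs ys →
    let _≲_ = λ x y → value k₁ (other p) a₁ (play a₁ D₁ x) ≤ value k₂ (other p) a₂ (play a₂ D₂ y)
    in All (λ x → Any (x ≲_) ys) xs → (∀ {x} → x List.∈ xs → All (λ y → Any (_≲ y) xs) ys) →
       valueL k₁ p a₁ D₁ xs ≤ valueL k₂ p a₂ D₂ ys
  valueL-mono p []       _        _        _    = z≤n
  valueL-mono p (x ∷ xs) []       (() ∷ _) _
  valueL-mono p (x ∷ xs) (y ∷ ys) forth    back =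
    s≤s (opt-mono p _ _ (x ∷ xs) y ys forth (back (Any.here refl)))

  -- The fuel k₂ suffices because every legal move in game 1 shrinks ∁ D₁.
  value-mono : ∀ k₁ k₂ p {D₁ D₂} → Ahead D₁ D₂ → ∣ ∁ D₁ ∣ ≤ k₂ →
               value k₁ p a₁ D₁ ≤ value k₂ p a₂ D₂
  value-mono zero     _        _ _ _ = z≤n
  value-mono (suc k₁) zero     p {D₁} r fuel = ≤-reflexive (valueL-no-moves (moves a₁ D₁)
    λ {x} x∈ → n≮0 (<-≤-trans (legal⇒∣∁∣-decreases a₁ D₁ x (∈-moves⁻ a₁ D₁ x∈)) fuel))
  value-mono (suc k₁) (suc k₂) p {D₁} {D₂} r fuel =
    valueL-mono p (moves a₁ D₁) (moves a₂ D₂) forth back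
    where
    _≲_ : Fin n₁ → Fin n₂ → Set
    x ≲ y = value k₁ (other p) a₁ (play a₁ D₁ x) ≤ value k₂ (other p) a₂ (play a₂ D₂ y)

    next : ∀ {x y} → T (legal a₁ D₁ x) → Ahead (play a₁ D₁ x) (play a₂ D₂ y) → x ≲ y
    next {x} l r′ =
      value-mono k₁ k₂ (other p) r′ (≤-pred (<-≤-trans (legal⇒∣∁∣-decreases a₁ D₁ x l) fuel))

    forth : All (λ x → Any (x ≲_) (moves a₂ D₂)) (moves a₁ D₁)
    forth = All.tabulate λ x∈ →
      let l = ∈-moves⁻ a₁ D₁ x∈ ; y , l′ , r′ = copy-move r l
      in lose (∈-moves⁺ a₂ D₂ l′) (next l r′)

    back : ∀ {x₀} → x₀ List.∈ moves a₁ D₁ → All (λ y → Any (_≲ y) (moves a₁ D₁)) (moves a₂ D₂)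
    back x₀∈ = All.tabulate λ {y} _ →
      let x , l , r′ = answer-move r (∈-moves⁻ a₁ D₁ x₀∈) y
      in lose (∈-moves⁺ a₁ D₁ l) (next l r′)

closedN-refl : ∀ (a : Adj n) x → T (closedN a x x)
closedN-refl a x = from (T-∨ {⌊ x ≟ x ⌋}) (inj₁ (fromWitness refl))

closedN-adj : ∀ (a : Adj n) x y → T (a x y) → T (closedN a x y)
closedN-adj a x y = from (T-∨ {⌊ x ≟ y ⌋}) ∘ inj₂

closedN⁻ : ∀ (a : Adj n) x y → T (closedN a x y) → x ≡ y ⊎ T (a x y)
closedN⁻ a x y = ⊎-map₁ toWitness ∘ to (T-∨ {⌊ x ≟ y ⌋})

module _ (a : Adj n) (u v : Fin n) where

  old : Fin n → Fin (suc (suc n))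
  old w = suc (suc w)

  Guv-old⁺ : ∀ {x w} → T (a x w) → ¬ ((x ≡ u × w ≡ v) ⊎ (x ≡ v × w ≡ u)) →
             T (Guv a u v (old x) (old w))
  Guv-old⁺ {x} {w} x~w not-uv =
    from T-∧ (x~w , ¬T⇒T-not
      (not-uv ∘ ⊎-map (both (x ≟ u) (w ≟ v)) (both (x ≟ v) (w ≟ u)) ∘ to T-∨))
    where
    both : ∀ {A B : Set} (a? : Dec A) (b? : Dec B) → T (⌊ a? ⌋ ∧ ⌊ b? ⌋) → A × B
    both a? b? = ×-map (toWitness {a? = a?}) (toWitness {a? = b?}) ∘ to (T-∧ {⌊ a? ⌋})

  old-covered : ∀ x → CoveredBy a (Guv a u v) old (old x) x
  old-covered x {z} x~z with closedN⁻ (Guv a u v) (old x) (old z) x~z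
  ... | inj₁ refl = closedN-refl a x
  ... | inj₂ x~′z = closedN-adj a x z (proj₁ (to T-∧ x~′z))

  u′-covered : ∀ {x} → T (closedN a x v) → CoveredBy a (Guv a u v) old zero x
  u′-covered {x} x~v z≡v = subst (T ∘ closedN a x) (≡-sym (toWitness z≡v)) x~v

  v′-covered : ∀ {x} → T (closedN a x u) → CoveredBy a (Guv a u v) old (suc zero) x
  v′-covered {x} x~u z≡u = subst (T ∘ closedN a x) (≡-sym (toWitness z≡u)) x~u

  project-Guv : Fin (suc (suc n)) → Fin n
  project-Guv zero          = v
  project-Guv (suc zero)    = u
  project-Guv (suc (suc w)) = w

  project-Guv-covers : ∀ y → CoveredBy a (Guv a u v) old y (project-Guv y)
  project-Guv-covers zero          = u′-covered (closedN-refl a v)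
  project-Guv-covers (suc zero)    = v′-covered (closedN-refl a u)
  project-Guv-covers (suc (suc w)) = old-covered w

  cover-Guv : ∀ {x w} → T (closedN a x w) →
              ∃[ y ] T (closedN (Guv a u v) y (old w)) × CoveredBy a (Guv a u v) old y x
  cover-Guv {x} {w} x~w with closedN⁻ a x w x~w
  ... | inj₁ refl = old x , closedN-refl (Guv a u v) (old x) , old-covered x
  cover-Guv {x} {w} x~w | inj₂ axw with (x ≟ u ×-dec w ≟ v) ⊎-dec (x ≟ v ×-dec w ≟ u)
  ... | yes (inj₁ (refl , refl)) = zero , fromWitness refl , u′-covered x~w
  ... | yes (inj₂ (refl , refl)) = suc zero , fromWitness refl , v′-covered x~w
  ... | no not-uv =
    old x , closedN-adj (Guv a u v) (old x) (old w) (Guv-old⁺ axw not-uv) , old-covered x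

  Guv-simulation : Simulation a (Guv a u v)
  Guv-simulation = record
    { ι              = old
    ; project        = project-Guv
    ; project-covers = project-Guv-covers
    ; cover          = cover-Guv
    }

theorem3p1 : ∀ {n} (G : Graph n) (A B : Subset n) → B ⊆ A →
    (u v : Fin n) → adj G u v ≡ true →
    (γg (adj G) A ≤ γg (Guv (adj G) u v) (liftB B))
      × (γg' (adj G) A ≤ γg' (Guv (adj G) u v) (liftB B))
theorem3p1 {n} G A B B⊆A u v _ =
  value-mono n (2 + n) Dominator ahead fuel , value-mono n (2 + n) Staller ahead fuel
  where
  open Simulate (Guv-simulation (adj G) u v)

  ahead : Ahead A (liftB B)
  ahead = B⊆A ∘ drop-there ∘ drop-there

  fuel : ∣ ∁ A ∣ ≤ 2 + n
  fuel = m≤n⇒m≤o+n 2 (∣p∣≤n (∁ A))
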